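{- Let $r\ge 1$ and $q\ge 3$ be integers and let $G$ be a minimal graph in $H_v(2_r;q)$. Then (a) $G$ is a vertex-critical chromatic graph with $\chi(G)=r+1$; (b) if $q<r+3$, then $\omega(G)=q-1$.
   Context: All graphs are finite, simple and undirected; $\chi(G)$ is the chromatic number and $\omega(G)$ the clique number. $G\overset{v}{\to}(2_r)$ means that for every partition of $V(G)$ into $r$ pairwise disjoint (possibly empty) sets, some part contains two adjacent vertices (equivalently $\chi(G)\ge r+1$). $H_v(2_r;q)$ is the set of graphs $G$ with $G\overset{v}{\to}(2_r)$ and $\omega(G)<q$. A minimal graph in a nonempty set $\mathcal M$ of graphs is a $G_0\in\mathcal M$ with $|V(G_0)|=\min\{|V(G)|:G\in\mathcal M\}$. A graph $G$ is vertex-critical chromatic if $\chi(G-v)<\chi(G)$ for every $v\in V(G)$. -}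

module Defs where

open import Data.Nat using (ℕ; zero; suc; _≤_; _<_; _+_; _∸_)
open import Data.Fin using (Fin; punchIn)
open import Data.Bool using (Bool; true; false)
open import Data.Product using (Σ; ∃; ∃-syntax; _×_; _,_)
open import Relation.Binary.PropositionalEquality using (_≡_; _≢_)
open import Relation.Nullary using (¬_)

record Graph (n : ℕ) : Set where
  field
    adj   : Fin n → Fin n → Bool
    sym   : ∀ x y → adj x y ≡ adj y x
    irrfl : ∀ x → adj x x ≡ false
open Graph public

Colorable : ∀ {n} → ℕ → Graph n → Set
Colorable {n} k G = Σ (Fin n → Fin k) λ c → ∀ x y → adj G x y ≡ true → c x ≢ c y

ChromaticNumber : ∀ {n} → Graph n → ℕ → Set
ChromaticNumber G k = Colorable k G × (∀ j → j < k → ¬ Colorable j G)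

-- G →v (2_r): every partition of V(G) into r (possibly empty) parts,
-- given as a map V(G) → Fin r, has a part containing two adjacent vertices.
VArrow : ∀ {n} → ℕ → Graph n → Set
VArrow {n} r G = ∀ (c : Fin n → Fin r) → ∃[ x ] ∃[ y ] (adj G x y ≡ true × c x ≡ c y)

HasClique : ∀ {n} → Graph n → ℕ → Set
HasClique {n} G k = Σ (Fin k → Fin n) λ f → ∀ i j → i ≢ j → adj G (f i) (f j) ≡ true

CliqueNumber : ∀ {n} → Graph n → ℕ → Set
CliqueNumber G k = HasClique G k × ¬ HasClique G (suc k)

InHv : ∀ {n} → ℕ → ℕ → Graph n → Set
InHv r q G = VArrow r G × ¬ HasClique G q

MinimalHv : ∀ {n} → ℕ → ℕ → Graph n → Set
MinimalHv {n} r q G = InHv r q G × (∀ m (H : Graph m) → InHv r q H → n ≤ m)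

deleteVertex : ∀ {n} → Graph (suc n) → Fin (suc n) → Graph n
deleteVertex G v = record
  { adj   = λ x y → adj G (punchIn v x) (punchIn v y)
  ; sym   = λ x y → sym G (punchIn v x) (punchIn v y)
  ; irrfl = λ x → irrfl G (punchIn v x)
  }

VertexCritical : ∀ {n} → Graph n → Set
VertexCritical {zero} G = Data.Unit.⊤ where import Data.Unit
VertexCritical {suc n} G = ∀ v → ∃[ k ] ∃[ k' ]
  (ChromaticNumber G k × ChromaticNumber (deleteVertex G v) k' × k' < k)

module Submission where

-- (a) Deleting a vertex from a minimal G keeps ω < q, so by minimality G - v is
-- r-colourable; giving v a fresh colour shows χ(G) = r + 1, and χ(G - v) ≤ r.
-- (b) If G had two distinct non-adjacent vertices u, w, join u to every other
-- vertex and delete w: merging w into u maps G homomorphically into the new graph,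
-- so it still arrows (2_r), and any q-clique of it minus u is a (q-1)-clique of G.
-- With ω(G) < q - 1 this smaller graph would contradict minimality, so G is
-- complete; then ω(G) = |V(G)| ≥ r + 1 ≥ q - 1.

open import Defs
open import Data.Nat using (ℕ; _≤_; _<_; _+_; _∸_; zero; suc; z≤n; s≤s)
open import Data.Nat.Properties
  using (≤-refl; ≤-trans; ≤-pred; m≤n⇒m≤1+n; <-irrefl; ≰⇒>; n≮0; +-comm)
open import Data.Fin using (Fin; fromℕ; inject₁; inject≤; punchIn; punchOut; funToFin; finToFun; _≟_)
open import Data.Fin.Properties
  using (any?; all?; suc-injective; inject₁-injective; fromℕ≢inject₁; inject≤-injective;
         punchIn-injective; punchInᵢ≢i; punchIn-punchOut; finToFun-funToFin)
open import Data.Vec.Functional using (_∷_)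
open import Data.Bool using (Bool; true; false)
import Data.Bool as Bool
open import Data.Product using (Σ; ∃-syntax; _×_; _,_)
open import Data.Empty using (⊥-elim)
open import Function using (id; _∘_)
open import Relation.Nullary using (¬_; Dec; yes; no; does)
open import Relation.Nullary.Decidable using (map′; ¬?; _×-dec_; _→-dec_)
open import Relation.Binary.PropositionalEquality
  using (_≡_; _≢_; _≗_; refl; trans; cong; subst; subst₂)
  renaming (sym to ≡-sym)

private
  variable
    n m k j r : ℕ

false≢true : false ≢ true
false≢true ()

adj⇒≢ : (G : Graph n) {x y : Fin n} → adj G x y ≡ true → x ≢ y
adj⇒≢ G {x} a refl = false≢true (trans (≡-sym (irrfl G x)) a)

ProperColoring : Graph n → (Fin n → Fin k) → Set
ProperColoring G c = ∀ x y → adj G x y ≡ true → c x ≢ c y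

MonochromaticEdge : Graph n → (Fin n → Fin k) → Set
MonochromaticEdge G c = ∃[ x ] ∃[ y ] (adj G x y ≡ true × c x ≡ c y)

IsClique : Graph n → (Fin k → Fin n) → Set
IsClique G f = ∀ i j → i ≢ j → adj G (f i) (f j) ≡ true

Homomorphism : Graph n → Graph m → (Fin n → Fin m) → Set
Homomorphism G H h = ∀ x y → adj G x y ≡ true → adj H (h x) (h y) ≡ true

-- Maps Fin n → Fin k are enumerated by Fin (k ^ n).
∃-map? : {P : (Fin n → Fin k) → Set} → (∀ {f g} → f ≗ g → P f → P g) →
         (∀ f → Dec (P f)) → Dec (Σ (Fin n → Fin k) P)
∃-map? resp P? = map′ (λ (i , p) → finToFun i , p)
                      (λ (f , p) → funToFin f , resp (≡-sym ∘ finToFun-funToFin f) p)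
                      (any? (P? ∘ finToFun))

properColoring? : (G : Graph n) (c : Fin n → Fin k) → Dec (ProperColoring G c)
properColoring? G c = all? λ x → all? λ y → (adj G x y Bool.≟ true) →-dec ¬? (c x ≟ c y)

colorable? : ∀ k (G : Graph n) → Dec (Colorable k G)
colorable? k G = ∃-map? respects (properColoring? G)
  where
  respects : ∀ {c d} → c ≗ d → ProperColoring G c → ProperColoring G d
  respects c≗d proper x y a eq = proper x y a (trans (c≗d x) (trans eq (≡-sym (c≗d y))))

isClique? : (G : Graph n) (f : Fin k → Fin n) → Dec (IsClique G f)
isClique? G f = all? λ i → all? λ j → ¬? (i ≟ j) →-dec (adj G (f i) (f j) Bool.≟ true)

hasClique? : (G : Graph n) → ∀ k → Dec (HasClique G k)
hasClique? G k = ∃-map? respects (isClique? G)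
  where
  respects : ∀ {f g} → f ≗ g → IsClique G f → IsClique G g
  respects f≗g clique i j i≢j =
    subst₂ (λ a b → adj G a b ≡ true) (f≗g i) (f≗g j) (clique i j i≢j)

monochromaticEdge? : (G : Graph n) (c : Fin n → Fin k) → Dec (MonochromaticEdge G c)
monochromaticEdge? G c = any? λ x → any? λ y → (adj G x y Bool.≟ true) ×-dec (c x ≟ c y)

¬Colorable⇒VArrow : (G : Graph n) → ¬ Colorable r G → VArrow r G
¬Colorable⇒VArrow G ¬col c with monochromaticEdge? G c
... | yes edge = edge
... | no ¬edge = ⊥-elim (¬col (c , λ x y a eq → ¬edge (x , y , a , eq)))

Colorable-mono : (G : Graph n) → j ≤ k → Colorable j G → Colorable k G
Colorable-mono G j≤k (c , proper) =
  (λ x → inject≤ (c x) j≤k) , λ x y a eq → proper x y a (inject≤-injective j≤k j≤k _ _ eq)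

VArrow⇒¬Colorable : (G : Graph n) → VArrow r G → j ≤ r → ¬ Colorable j G
VArrow⇒¬Colorable G arrow j≤r col with Colorable-mono G j≤r col
... | c , proper with arrow c
...   | x , y , a , eq = proper x y a eq

VArrow⇒< : (G : Graph n) → VArrow r G → r < n
VArrow⇒< G arrow = ≰⇒> λ n≤r → VArrow⇒¬Colorable G arrow n≤r (id , λ x y → adj⇒≢ G)

Colorable⇒ChromaticNumber≤ : (G : Graph n) {k : ℕ} → Colorable k G → ∃[ χ ] (χ ≤ k × ChromaticNumber G χ)
Colorable⇒ChromaticNumber≤ G {zero} col = zero , z≤n , col , λ _ ()
Colorable⇒ChromaticNumber≤ G {suc k} col with colorable? k G
... | yes colₖ with Colorable⇒ChromaticNumber≤ G colₖ
...   | χ , χ≤k , isχ = χ , m≤n⇒m≤1+n χ≤k , isχ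
Colorable⇒ChromaticNumber≤ G {suc k} col | no ¬colₖ =
  suc k , ≤-refl , col , λ j j<1+k colⱼ → ¬colₖ (Colorable-mono G (≤-pred j<1+k) colⱼ)

Colorable-deleteVertex-zero : (G : Graph (suc n)) → Colorable r (deleteVertex G Fin.zero) → Colorable (suc r) G
Colorable-deleteVertex-zero {r = r} G (c , proper) = fresh , proper′
  where
  fresh : Fin _ → Fin (suc r)
  fresh = fromℕ r ∷ inject₁ ∘ c

  proper′ : ProperColoring G fresh
  proper′ Fin.zero    Fin.zero    a _  = adj⇒≢ G a refl
  proper′ Fin.zero    (Fin.suc y) _ eq = fromℕ≢inject₁ eq
  proper′ (Fin.suc x) Fin.zero    _ eq = fromℕ≢inject₁ (≡-sym eq)
  proper′ (Fin.suc x) (Fin.suc y) a eq = proper x y a (inject₁-injective eq)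

VArrow-hom : (G : Graph n) (H : Graph m) (h : Fin n → Fin m) →
             Homomorphism G H h → VArrow r G → VArrow r H
VArrow-hom G H h hom arrow c with arrow (c ∘ h)
... | x , y , a , eq = h x , h y , hom x y a , eq

Homomorphism-deleteVertex : (G : Graph n) (H : Graph (suc m)) (h : Fin n → Fin (suc m)) (w : Fin (suc m))
  (avoids : ∀ x → w ≢ h x) → Homomorphism G H h →
  Homomorphism G (deleteVertex H w) (λ x → punchOut (avoids x))
Homomorphism-deleteVertex G H h w avoids hom x y a =
  subst₂ (λ s t → adj H s t ≡ true)
         (≡-sym (punchIn-punchOut (avoids x))) (≡-sym (punchIn-punchOut (avoids y)))
         (hom x y a)

HasClique-deleteVertex : (G : Graph (suc n)) (v : Fin (suc n)) → HasClique (deleteVertex G v) k → HasClique G k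
HasClique-deleteVertex G v (f , clique) = punchIn v ∘ f , clique

HasClique-≤ : (G : Graph n) → j ≤ k → HasClique G k → HasClique G j
HasClique-≤ G j≤k (f , clique) =
  (λ i → f (inject≤ i j≤k)) , λ a b a≢b → clique _ _ (a≢b ∘ inject≤-injective j≤k j≤k _ _)

clique-injective : (G : Graph n) (f : Fin k → Fin n) → IsClique G f → ∀ {i j} → f i ≡ f j → i ≡ j
clique-injective G f clique {i} {j} eq with i ≟ j
... | yes i≡j = i≡j
... | no  i≢j = ⊥-elim (adj⇒≢ G (clique i j i≢j) eq)

clique-avoiding : (G : Graph n) (f : Fin (suc k) → Fin n) → IsClique G f → (u : Fin n) →
                  Σ (Fin k → Fin n) λ g → IsClique G g × (∀ i → g i ≢ u)
clique-avoiding G f clique u with any? (λ i → f i ≟ u)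
... | yes (i , fi≡u) =
  f ∘ punchIn i , (λ a b a≢b → clique _ _ (a≢b ∘ punchIn-injective i a b)) ,
  λ a eq → punchInᵢ≢i i a (clique-injective G f clique (trans eq (≡-sym fi≡u)))
... | no ∄i = f ∘ Fin.suc , (λ a b a≢b → clique _ _ (a≢b ∘ suc-injective)) , λ a eq → ∄i (Fin.suc a , eq)

apexAdj : Bool → Bool → Bool → Bool
apexAdj true  true  _ = false
apexAdj true  false _ = true
apexAdj false true  _ = true
apexAdj false false b = b

apexAdj-comm : ∀ a b c → apexAdj a b c ≡ apexAdj b a c
apexAdj-comm true  true  _ = refl
apexAdj-comm true  false _ = refl
apexAdj-comm false true  _ = refl
apexAdj-comm false false _ = refl

apexAdj-diag : ∀ a → apexAdj a a false ≡ false
apexAdj-diag true  = refl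
apexAdj-diag false = refl

cone : Graph n → Fin n → Graph n
cone G u = record
  { adj   = λ x y → apexAdj (apex x) (apex y) (adj G x y)
  ; sym   = λ x y → trans (cong (apexAdj (apex x) (apex y)) (Graph.sym G x y))
                          (apexAdj-comm (apex x) (apex y) (adj G y x))
  ; irrfl = λ x → trans (cong (apexAdj (apex x) (apex x)) (irrfl G x)) (apexAdj-diag (apex x))
  }
  where
  apex : Fin _ → Bool
  apex x = does (x ≟ u)

module _ (G : Graph n) (u : Fin n) where

  cone-apex : ∀ {y} → y ≢ u → adj (cone G u) u y ≡ true
  cone-apex {y} y≢u with u ≟ u | y ≟ u
  ... | no u≢u | _      = ⊥-elim (u≢u refl)
  ... | yes _  | yes y≡u = ⊥-elim (y≢u y≡u)
  ... | yes _  | no _   = refl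

  cone-outside : ∀ {x y} → x ≢ u → y ≢ u → adj (cone G u) x y ≡ adj G x y
  cone-outside {x} {y} x≢u y≢u with x ≟ u | y ≟ u
  ... | yes x≡u | _       = ⊥-elim (x≢u x≡u)
  ... | no _    | yes y≡u = ⊥-elim (y≢u y≡u)
  ... | no _    | no _    = refl

  cone-⊇ : ∀ {x y} → adj G x y ≡ true → adj (cone G u) x y ≡ true
  cone-⊇ {x} {y} a with x ≟ u | y ≟ u
  ... | yes refl | yes refl = ⊥-elim (adj⇒≢ G a refl)
  ... | yes _    | no _     = refl
  ... | no _     | yes _    = refl
  ... | no _     | no _     = a

  cone-¬HasClique : ¬ HasClique G k → ¬ HasClique (cone G u) (suc k)
  cone-¬HasClique ¬clique (f , clique) with clique-avoiding (cone G u) f clique u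
  ... | g , clique′ , avoids =
    ¬clique (g , λ i j i≢j → trans (≡-sym (cone-outside (avoids i) (avoids j))) (clique′ i j i≢j))

module Contraction (G : Graph (suc n)) {u w : Fin (suc n)} (u≢w : u ≢ w) (u≁w : adj G u w ≡ false) where

  contraction : Graph n
  contraction = deleteVertex (cone G u) w

  merge : Fin (suc n) → Fin (suc n)
  merge x with x ≟ w
  ... | yes _ = u
  ... | no  _ = x

  merge-avoids : ∀ x → w ≢ merge x
  merge-avoids x with x ≟ w
  ... | yes _   = u≢w ∘ ≡-sym
  ... | no  x≢w = x≢w ∘ ≡-sym

  neighbour≢u : ∀ {y} → adj G w y ≡ true → y ≢ u
  neighbour≢u a refl = false≢true (trans (≡-sym u≁w) (trans (Graph.sym G _ w) a))

  merge-hom : Homomorphism G (cone G u) merge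
  merge-hom x y a with x ≟ w | y ≟ w
  ... | yes refl | yes refl = ⊥-elim (adj⇒≢ G a refl)
  ... | yes refl | no _     = cone-apex G u (neighbour≢u a)
  ... | no _     | yes refl =
    trans (Graph.sym (cone G u) x u) (cone-apex G u (neighbour≢u (trans (Graph.sym G w x) a)))
  ... | no _     | no _     = cone-⊇ G u a

  contraction-VArrow : VArrow r G → VArrow r contraction
  contraction-VArrow = VArrow-hom G contraction _
    (Homomorphism-deleteVertex G (cone G u) merge w merge-avoids merge-hom)

  contraction-¬HasClique : ¬ HasClique G k → ¬ HasClique contraction (suc k)
  contraction-¬HasClique ¬clique = cone-¬HasClique G u ¬clique ∘ HasClique-deleteVertex (cone G u) w

module Minimal {k} (G : Graph (suc m)) (arrow : VArrow r G) (¬clique : ¬ HasClique G (suc k))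
               (smallest : ∀ n (H : Graph n) → InHv r (suc k) H → suc m ≤ n) where

  smaller-∉Hv : (H : Graph m) → ¬ InHv r (suc k) H
  smaller-∉Hv H inHv = <-irrefl refl (smallest m H inHv)

  deleteVertex-colorable : ∀ v → Colorable r (deleteVertex G v)
  deleteVertex-colorable v with colorable? r (deleteVertex G v)
  ... | yes col = col
  ... | no ¬col = ⊥-elim (smaller-∉Hv (deleteVertex G v)
                    (¬Colorable⇒VArrow (deleteVertex G v) ¬col , ¬clique ∘ HasClique-deleteVertex G v))

  chromaticNumber : ChromaticNumber G (suc r)
  chromaticNumber = Colorable-deleteVertex-zero G (deleteVertex-colorable Fin.zero) ,
                    λ j j<1+r → VArrow⇒¬Colorable G arrow (≤-pred j<1+r)

  vertexCritical : VertexCritical G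
  vertexCritical v with Colorable⇒ChromaticNumber≤ (deleteVertex G v) (deleteVertex-colorable v)
  ... | χ , χ≤r , isχ = suc r , χ , chromaticNumber , isχ , s≤s χ≤r

  complete : ¬ HasClique G k → IsClique G id
  complete ¬cliqueₖ u w u≢w with adj G u w in u≁w
  ... | true  = refl
  ... | false = ⊥-elim (smaller-∉Hv contraction (contraction-VArrow arrow , contraction-¬HasClique ¬cliqueₖ))
    where open Contraction G u≢w u≁w

  cliqueNumber : k ≤ suc r → CliqueNumber G k
  cliqueNumber k≤1+r with hasClique? G k
  ... | yes cliqueₖ = cliqueₖ , ¬clique
  ... | no ¬cliqueₖ = ⊥-elim (¬cliqueₖ
          (HasClique-≤ G (≤-trans k≤1+r (VArrow⇒< G arrow)) (id , complete ¬cliqueₖ)))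

lemma2p2 : (r q n : ℕ) → 1 ≤ r → 3 ≤ q → (G : Graph n) → MinimalHv r q G
    → (VertexCritical G × ChromaticNumber G (r + 1))
    × (q < r + 3 → CliqueNumber G (q ∸ 1))
lemma2p2 r zero    n       _ () G _
lemma2p2 r (suc k) zero    _ _ G ((arrow , _) , _) = ⊥-elim (n≮0 (VArrow⇒< G arrow))
lemma2p2 r (suc k) (suc m) _ _ G ((arrow , ¬clique) , smallest) =
  (vertexCritical , subst (ChromaticNumber G) (+-comm 1 r) chromaticNumber) ,
  λ 1+k<r+3 → cliqueNumber (≤-pred (≤-pred (subst (suc (suc k) ≤_) (+-comm r 3) 1+k<r+3)))
  where open Minimal G arrow ¬clique smallest
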